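{- Let $a\ge 0$, $c\ge 1$, $e\ge 1$ be integers, and let $D=e(e+1)(e-a)(e-a-1)$ and $F=(e+1)(e^2+2e-a)(e^2+3e-a)$. If $e=a$, then the pair of conditions "$c$ divides $D$ and $c+2e-a$ divides $F$" is equivalent to the single condition that $c+e$ divides $e^2(e+1)^2(e+2)$. If $e=a+1$, then the pair of conditions is equivalent to the single condition that $c+e+1$ divides $(e+1)^3(e^2+e+1)$.
   Context: These are the integrality conditions that the parameters $(a,c,e)$ of a strongly regular graph with parameters $(n,k,a,c)$ and integer positive eigenvalue $e$ (other than $k$) must satisfy. -}

module Defs where

open import Data.Integer using (ℤ; _+_; _-_; _*_; +_)

D : ℤ → ℤ → ℤ
D a e = e * (e + + 1) * (e - a) * (e - a - + 1)

F : ℤ → ℤ → ℤ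
F a e = (e + + 1) * (e * e + + 2 * e - a) * (e * e + + 3 * e - a)

-- At e = a and at e = a + 1 the factor (e − a)(e − a − 1) of D vanishes, so
-- "c ∣ D" holds for every c and the pair of conditions collapses to its
-- second half.  Substituting e, the modulus c + 2e − a becomes c + e resp.
-- c + e + 1 and F factors as e²(e+1)²(e+2) resp. (e+1)³(e² + e + 1).
module Submission where

open import Defs
open import Data.Integer using (ℤ; _+_; _-_; _*_; +_; _≤_)
open import Data.Integer.Divisibility using (_∣_)
open import Data.Integer.Tactic.RingSolver using (solve-∀)
import Data.Nat.Divisibility as ℕ
open import Data.Product using (_×_; _,_; proj₂)
open import Function.Bundles using (_⇔_; mk⇔)
open import Relation.Binary.PropositionalEquality using (_≡_; refl; sym; subst₂)

∣0 : ∀ n {z} → z ≡ + 0 → n ∣ z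
∣0 n refl = ℕ._∣0 _

×-∣0-⇔ : ∀ c {m n x y z} → z ≡ + 0 → x ≡ m → y ≡ n → (c ∣ z × x ∣ y) ⇔ (m ∣ n)
×-∣0-⇔ c z≡0 x≡m y≡n = mk⇔
  (λ p → subst₂ _∣_ x≡m y≡n (proj₂ p))
  (λ q → ∣0 c z≡0 , subst₂ _∣_ (sym x≡m) (sym y≡n) q)

-- The ring solver does not unfold D and F, hence the explicitly unfolded copies.
D-diagonal : ∀ e → D e e ≡ + 0
D-diagonal = unfolded
  where
  unfolded : ∀ e → e * (e + + 1) * (e - e) * (e - e - + 1) ≡ + 0
  unfolded = solve-∀

F-diagonal : ∀ e → F e e ≡ e * e * (e + + 1) * (e + + 1) * (e + + 2)
F-diagonal = unfolded
  where
  unfolded : ∀ e → (e + + 1) * (e * e + + 2 * e - e) * (e * e + + 3 * e - e)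
                 ≡ e * e * (e + + 1) * (e + + 1) * (e + + 2)
  unfolded = solve-∀

D-subdiagonal : ∀ a → D a (a + + 1) ≡ + 0
D-subdiagonal = unfolded
  where
  unfolded : ∀ a → (a + + 1) * (a + + 1 + + 1) * (a + + 1 - a) * (a + + 1 - a - + 1) ≡ + 0
  unfolded = solve-∀

F-subdiagonal : ∀ a → let e = a + + 1 in
  F a e ≡ (e + + 1) * (e + + 1) * (e + + 1) * (e * e + e + + 1)
F-subdiagonal = unfolded
  where
  unfolded : ∀ a → let e = a + + 1 in
    (e + + 1) * (e * e + + 2 * e - a) * (e * e + + 3 * e - a)
      ≡ (e + + 1) * (e + + 1) * (e + + 1) * (e * e + e + + 1)
  unfolded = solve-∀

modulus-diagonal : ∀ c e → c + + 2 * e - e ≡ c + e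
modulus-diagonal = solve-∀

modulus-subdiagonal : ∀ c a → c + + 2 * (a + + 1) - a ≡ c + (a + + 1) + + 1
modulus-subdiagonal = solve-∀

corollary3p2 : (a c e : ℤ) → + 0 ≤ a → + 1 ≤ c → + 1 ≤ e →
    (e ≡ a → ((c ∣ D a e) × ((c + + 2 * e - a) ∣ F a e)) ⇔ ((c + e) ∣ (e * e * (e + + 1) * (e + + 1) * (e + + 2))))
    × (e ≡ a + + 1 → ((c ∣ D a e) × ((c + + 2 * e - a) ∣ F a e)) ⇔ ((c + e + + 1) ∣ ((e + + 1) * (e + + 1) * (e + + 1) * (e * e + e + + 1))))
corollary3p2 a c e _ _ _ =
    (λ { refl → ×-∣0-⇔ c (D-diagonal e) (modulus-diagonal c e) (F-diagonal e) })
  , (λ { refl → ×-∣0-⇔ c (D-subdiagonal a) (modulus-subdiagonal c a) (F-subdiagonal a) })
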